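{- For every run of the roundabout exploration process, with $t=\lfloor N/(2k)\rfloor$ we have $|A(t)|\le 6k$.
   Context: Let $n\ge2$ and $k\ge1$ be integers, and let $T$ be a tree on a vertex set $V$ with $|V|=n$, rooted at $r$. DFS tour. Fix a depth-first-search tour of $T$ that starts and ends at $r$ and traverses each edge of $T$ exactly twice. Write it as $(v_1,\dots,v_N,v_{N+1})$ with $v_1=v_{N+1}=r$ and $N=2(n-1)$, and put $e_i=\{v_i,v_{i+1}\}$ for $i\in[N]$. Circular intervals. For $i,j\in[N]$, let $[i,j]=\{i,\dots,j\}$ if $i\le j$, and $[i,j]=\{i,\dots,N,1,\dots,j\}$ if $i>j$. Snapshots. Let $G_1,\dots,G_N$ be graphs on $V$, each containing all but at most $k$ edges of $T$. Roundabout exploration process. There are agents $a_1,\dots,a_N$ with initial states $s_i(0)=i$. Set $D_i(0)=\{i\}$ and $A(0)=\{a_1,\dots,a_N\}$. For $t=1,\dots,N$ do: (1) Movement: if $s_i(t-1)=q$, then $s_i(t)=(q\bmod N)+1$ if $e_q\in E(G_t)$, and $s_i(t)=q$ otherwise. (2) Elimination: let $D_i(t)=[i,s_i(t)]$. Starting from $A(t-1)$, repeatedly remove an arbitrary agent $a_i$ of the current set with $D_i(t)\subseteq\bigcup_{a_j\text{ in current set},\,j\neq i}D_j(t)$, until no such agent remains. The result is $A(t)$. A run is any execution of this process, i.e. any choice of removed agents. -}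

module Defs where

open import Data.Nat using (ℕ; zero; suc; _+_; _*_; _∸_; _≤_; _<_; _/_; _%_; _≤ᵇ_; _≡ᵇ_)
open import Data.Bool using (Bool; true; false; _∧_; _∨_; not; if_then_else_)
open import Data.Fin using (Fin; toℕ; _≟_)
open import Data.List using (List; []; _∷_; _++_; [_]; length; filterᵇ; upTo; map; concatMap; allFin)
open import Data.List.Relation.Unary.Unique.Propositional using (Unique)
open import Data.List.Relation.Unary.Linked using (Linked)
open import Data.Product using (Σ; _×_; _,_; ∃; proj₁; proj₂)
open import Data.Sum using (_⊎_)
open import Data.Empty using (⊥)
open import Relation.Nullary using (¬_; does)
open import Relation.Binary.PropositionalEquality using (_≡_; _≢_)
open import Relation.Binary.Construct.Closure.ReflexiveTransitive using (Star)

record Graph (n : ℕ) : Set where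
  field
    adj    : Fin n → Fin n → Bool
    sym    : ∀ u w → adj u w ≡ adj w u
    irrefl : ∀ u → adj u u ≡ false
open Graph public

Adj : ∀ {n} → Graph n → Fin n → Fin n → Set
Adj G u w = adj G u w ≡ true

data Walk {n} (G : Graph n) : Fin n → Fin n → Set where
  here : ∀ {u} → Walk G u u
  step : ∀ {u x w} → Adj G u x → Walk G x w → Walk G u w

Connected : ∀ {n} → Graph n → Set
Connected G = ∀ u w → Walk G u w

IsCycle : ∀ {n} → Graph n → List (Fin n) → Set
IsCycle G [] = ⊥
IsCycle G (x ∷ xs) =
  (2 ≤ length xs) × Unique (x ∷ xs) × Linked (Adj G) (x ∷ xs ++ [ x ])

Acyclic : ∀ {n} → Graph n → Set
Acyclic G = ∀ xs → ¬ IsCycle G xs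

IsTree : ∀ {n} → Graph n → Set
IsTree G = Connected G × Acyclic G

range1 : ℕ → List ℕ
range1 N = map suc (upTo N)

countIn : ℕ → (ℕ → Bool) → ℕ
countIn N P = length (filterᵇ P (range1 N))

_==_ : ∀ {n} → Fin n → Fin n → Bool
x == y = does (x ≟ y)

unorderedPairs : ∀ n → List (Fin n × Fin n)
unorderedPairs n =
  filterᵇ (λ p → suc (toℕ (proj₁ p)) ≤ᵇ toℕ (proj₂ p))
         (concatMap (λ u → map (λ w → (u , w)) (allFin n)) (allFin n))

missingEdges : ∀ {n} → Graph n → Graph n → ℕ
missingEdges {n} T G =
  length (filterᵇ (λ p → adj T (proj₁ p) (proj₂ p) ∧ not (adj G (proj₁ p) (proj₂ p)))
                  (unorderedPairs n))

-- DFS tour: (v₁,…,v_N,v_{N+1}) with v₁ = v_{N+1} = r, consecutive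
-- vertices adjacent in T, and each edge of T traversed exactly twice.
-- (Indices are natural numbers 1,…,N+1; values of v elsewhere are irrelevant.)

sameEdge : ∀ {n} → Fin n → Fin n → Fin n → Fin n → Bool
sameEdge a b u w = (a == u ∧ b == w) ∨ (a == w ∧ b == u)

record IsDFSTour {n} (T : Graph n) (r : Fin n) (N : ℕ) (v : ℕ → Fin n) : Set where
  field
    start  : v 1 ≡ r
    end    : v (suc N) ≡ r
    walk   : ∀ i → 1 ≤ i → i ≤ N → Adj T (v i) (v (suc i))
    twice  : ∀ u w → Adj T u w →
             countIn N (λ i → sameEdge (v i) (v (suc i)) u w) ≡ 2

InCirc : ℕ → ℕ → ℕ → ℕ → Set
InCirc N i j x =
  1 ≤ x × x ≤ N × ((i ≤ j × i ≤ x × x ≤ j) ⊎ (j < i × (i ≤ x ⊎ x ≤ j)))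

-- (q mod N) + 1   (N > 0 in our use)
succMod : ℕ → ℕ → ℕ
succMod zero    q = 1
succMod (suc M) q = suc (q % suc M)

divFloor : ℕ → ℕ → ℕ
divFloor m zero    = 0
divFloor m (suc d) = m / suc d

-- Roundabout exploration process.
-- s i t   = s_i(t), the state of agent a_i at time t;
-- A t i   = true iff agent a_i ∈ A(t);  agents are a_1,…,a_N.

inRange : ℕ → ℕ → Bool
inRange N j = (1 ≤ᵇ j) ∧ (j ≤ᵇ N)

-- D_i(t) ⊆ ⋃_{a_j ∈ X, j ≠ i} D_j(t)
Covered : ℕ → (ℕ → ℕ) → (ℕ → Bool) → ℕ → Set
Covered N st X i =
  ∀ x → InCirc N i (st i) x →
    ∃ λ j → X j ≡ true × j ≢ i × InCirc N j (st j) x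

ElimStep : ℕ → (ℕ → ℕ) → (ℕ → Bool) → (ℕ → Bool) → Set
ElimStep N st X Y =
  ∃ λ i → X i ≡ true × Covered N st X i × (∀ j → Y j ≡ (X j ∧ not (j ≡ᵇ i)))

-- Y is reached from X by finitely many elimination steps
-- (sets compared pointwise at the end)
ElimReach : ℕ → (ℕ → ℕ) → (ℕ → Bool) → (ℕ → Bool) → Set
ElimReach N st X Y =
  ∃ λ Z → Star (ElimStep N st) X Z × (∀ j → Z j ≡ Y j)

ElimDone : ℕ → (ℕ → ℕ) → (ℕ → Bool) → Set
ElimDone N st X = ∀ i → X i ≡ true → ¬ Covered N st X i

record IsRun {n} (N : ℕ) (v : ℕ → Fin n) (G : ℕ → Graph n)
             (s : ℕ → ℕ → ℕ) (A : ℕ → ℕ → Bool) : Set where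
  field
    s-init : ∀ i → 1 ≤ i → i ≤ N → s i 0 ≡ i
    A-init : ∀ j → A 0 j ≡ inRange N j
    move   : ∀ t → 1 ≤ t → t ≤ N → ∀ i → 1 ≤ i → i ≤ N →
             s i t ≡ (if adj (G t) (v (s i (t ∸ 1))) (v (suc (s i (t ∸ 1))))
                        then succMod N (s i (t ∸ 1))
                        else s i (t ∸ 1))
    elim   : ∀ t → 1 ≤ t → t ≤ N → ElimReach N (λ i → s i t) (A (t ∸ 1)) (A t)
    done   : ∀ t → 1 ≤ t → t ≤ N → ElimDone N (λ i → s i t) (A t)

-- Charge every pair (a, τ) of a surviving agent a ∈ A(t) and a time τ ≤ t to an event: the
-- state s_a(τ) if τ = 0 or a advanced at step τ, and otherwise the pair (τ, e) of the step
-- and the edge e of T, missing from G_τ, that blocked a. There are at most N + t k events,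
-- and each is charged at most twice. Since t < N, no agent completes a turn, so an agent
-- arrives at each point at most once; the agents charged to a point p are therefore distinct,
-- and their intervals D_a(t) all contain p. Among three such intervals one is covered by the
-- other two (take the one reaching furthest back from p, and of the remaining two the one
-- reaching less far ahead), contradicting the end of the elimination. Agents in the same
-- state stay together, and two survivors cannot share an endpoint, so agents blocked at the
-- same step are in distinct states; three of them blocked by the same edge would be three
-- traversals of that edge by the tour, which crosses it only twice. Hence
-- |A(t)| (t + 1) ≤ 2 (N + t k), and t = ⌊N/(2k)⌋ gives |A(t)| < 6k.
module Submission where

open import Defs hiding (sym)

open import Data.Bool using (Bool; true; false; if_then_else_; _∧_; not)
open import Data.Bool.Properties using (T-≡; ∨-zeroʳ)
open import Data.Empty using (⊥; ⊥-elim)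
open import Data.Fin using (Fin; toℕ) renaming (_≟_ to _≟ᶠ_)
open import Data.Fin.Properties using (toℕ-injective)
open import Data.List using (List; []; _∷_; _++_; length; filterᵇ; filter; map; upTo; allFin; cartesianProduct)
open import Data.List.Membership.Propositional using (_∈_; lose)
open import Data.List.Membership.Propositional.Properties
  using (∈-filter⁺; ∈-filter⁻; ∈-concatMap⁺; ∈-allFin; ∈-map⁺; ∈-map⁻; ∈-upTo⁺; ∈-upTo⁻; ∈-++⁺ˡ; ∈-++⁺ʳ;
         ∈-cartesianProduct⁻)
open import Data.List.Properties using (length-map; length-upTo; length-++; length-filter)
open import Data.List.Relation.Unary.All using (_∷_)
open import Data.List.Relation.Unary.AllPairs using (_∷_)
open import Data.List.Relation.Unary.Any using (here; there)
open import Data.List.Relation.Unary.Unique.Propositional using (Unique)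
open import Data.List.Relation.Unary.Unique.Propositional.Properties
  using (filter⁺; map⁺; upTo⁺; cartesianProduct⁺)
open import Data.Nat
open import Data.Nat.DivMod using (m<n⇒m%n≡m; n%n≡0; m≡m%n+[m/n]*n; m%n<n; m/n*n≤m)
open import Data.Nat.Properties
open import Algebra.Properties.CommutativeSemigroup +-commutativeSemigroup using (interchange; xy∙z≈xz∙y)
open import Data.Nat.Tactic.RingSolver using (solve-∀)
open import Data.Product using (_×_; _,_; proj₁; proj₂; ∃-syntax)
import Data.Product.Properties as ×
open import Data.Sum using (_⊎_; inj₁; inj₂)
import Data.Sum.Properties as ⊎
open import Data.Unit using (⊤; tt)
open import Function using (_∘_)
open import Function.Bundles using (Equivalence)
open import Relation.Binary.Definitions using (DecidableEquality; tri<; tri≈; tri>)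
open import Relation.Binary.PropositionalEquality
open import Relation.Nullary using (¬_; yes; no; does; contradiction)
open import Relation.Nullary.Decidable using (dec-true; T?)
open import Relation.Unary using (Decidable)
open import Relation.Unary.Properties using (∁?)

-- Clockwise distance on the cycle 1, …, N

OnCycle : ℕ → ℕ → Set
OnCycle N x = 1 ≤ x × x ≤ N

cwDist : ℕ → ℕ → ℕ → ℕ
cwDist N a b with a ≤? b
... | yes _ = b ∸ a
... | no  _ = N + b ∸ a

cwDist-≤ : ∀ {N a b} → a ≤ b → cwDist N a b ≡ b ∸ a
cwDist-≤ {N} {a} {b} a≤b with a ≤? b
... | yes _   = refl
... | no  a≰b = contradiction a≤b a≰b

cwDist-> : ∀ {N a b} → b < a → cwDist N a b ≡ N + b ∸ a
cwDist-> {N} {a} {b} b<a with a ≤? b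
... | yes a≤b = contradiction a≤b (<⇒≱ b<a)
... | no  _   = refl

cwDist-self : ∀ {N} a → cwDist N a a ≡ 0
cwDist-self {N} a = trans (cwDist-≤ {N} (≤-refl {a})) (n∸n≡0 a)

Clockwise : ℕ → ℕ → ℕ → ℕ → Set
Clockwise N a d b = d < N × ∃[ m ] a + d ≡ b + m * N

cwDist-clockwise : ∀ {N a b} → OnCycle N a → OnCycle N b → Clockwise N a (cwDist N a b) b
cwDist-clockwise {N} {a} {b} (1≤a , a≤N) (_ , b≤N) with a ≤? b
... | yes a≤b = d<N , 0 , trans (m+[n∸m]≡n a≤b) (sym (+-identityʳ b))
  where
  d<N : b ∸ a < N
  d<N = ≤-trans (+-monoˡ-≤ (b ∸ a) 1≤a) (subst (_≤ N) (sym (m+[n∸m]≡n a≤b)) b≤N)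
... | no  a≰b = d<N , 1 , trans wraps (cong (b +_) (sym (*-identityˡ N)))
  where
  wraps : a + (N + b ∸ a) ≡ b + N
  wraps = trans (m+[n∸m]≡n (≤-trans a≤N (m≤m+n N b))) (+-comm N b)
  d<N : N + b ∸ a < N
  d<N = +-cancelˡ-< a _ _ (subst (_< a + N) (sym wraps) (+-monoˡ-< N (≰⇒> a≰b)))

clockwise-trans : ∀ {N a b c d₁ d₂} → Clockwise N a d₁ b → Clockwise N b d₂ c →
                  ∃[ m ] a + (d₁ + d₂) ≡ c + m * N
clockwise-trans {N} {a} {b} {c} {d₁} {d₂} (_ , m₁ , ab) (_ , m₂ , bc) = m₂ + m₁ , (begin
  a + (d₁ + d₂)          ≡⟨ +-assoc a d₁ d₂ ⟨
  (a + d₁) + d₂          ≡⟨ cong (_+ d₂) ab ⟩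
  (b + m₁ * N) + d₂      ≡⟨ xy∙z≈xz∙y b (m₁ * N) d₂ ⟩
  (b + d₂) + m₁ * N      ≡⟨ cong (_+ m₁ * N) bc ⟩
  (c + m₂ * N) + m₁ * N  ≡⟨ +-assoc c (m₂ * N) (m₁ * N) ⟩
  c + (m₂ * N + m₁ * N)  ≡⟨ cong (c +_) (*-distribʳ-+ N m₂ m₁) ⟨
  c + (m₂ + m₁) * N      ∎)
  where open ≡-Reasoning

private
  cancel-common : ∀ {a c x y x′ y′} → a + x ≡ c + y → a + x′ ≡ c + y′ → x + y′ ≡ x′ + y
  cancel-common {a} {c} {x} {y} {x′} {y′} e e′ = +-cancelˡ-≡ (a + c) _ _ (begin
    (a + c) + (x + y′)  ≡⟨ interchange a c x y′ ⟩
    (a + x) + (c + y′)  ≡⟨ cong₂ _+_ e (sym e′) ⟩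
    (c + y) + (a + x′)  ≡⟨ +-comm (c + y) (a + x′) ⟩
    (a + x′) + (c + y)  ≡⟨ interchange a c x′ y ⟨
    (a + c) + (x′ + y)  ∎)
    where open ≡-Reasoning

  +-*-mono-< : ∀ {N x y m m′} → x < y + N → m < m′ → x + m * N < y + m′ * N
  +-*-mono-< {N} {x} {y} {m} {m′} x<y+N m<m′ = begin-strict
    x + m * N        <⟨ +-monoˡ-< (m * N) x<y+N ⟩
    (y + N) + m * N  ≡⟨ +-assoc y N (m * N) ⟩
    y + suc m * N    ≤⟨ +-monoʳ-≤ y (*-monoˡ-≤ N m<m′) ⟩
    y + m′ * N       ∎
    where open ≤-Reasoning

  +-*-cancel-< : ∀ {N x y m m′} → y < N → x < y + N → x + m * N ≡ y + m′ * N → x ≡ y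
  +-*-cancel-< {N} {x} {y} {m} {m′} y<N x<y+N e with <-cmp m m′
  ... | tri≈ _ refl _ = +-cancelʳ-≡ (m * N) x y e
  ... | tri< m<m′ _ _ = contradiction e (<⇒≢ (+-*-mono-< x<y+N m<m′))
  ... | tri> _ _ m′<m = contradiction (sym e) (<⇒≢ (+-*-mono-< (<-≤-trans y<N (m≤n+m N x)) m′<m))

module _ {N a b c} (a∈ : OnCycle N a) (b∈ : OnCycle N b) (c∈ : OnCycle N c) where

  cwDist-split : cwDist N a b + cwDist N b c < cwDist N a c + N →
                 cwDist N a c ≡ cwDist N a b + cwDist N b c
  cwDist-split lt with clockwise-trans (cwDist-clockwise a∈ b∈) (cwDist-clockwise b∈ c∈)
                     | cwDist-clockwise {N} a∈ c∈
  ... | m , abc | ac<N , m′ , ac = sym (+-*-cancel-< {m = m′} {m} ac<N lt (cancel-common {a} {c} abc ac))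

  cwDist-splitˡ : cwDist N a b ≤ cwDist N a c → cwDist N a c ≡ cwDist N a b + cwDist N b c
  cwDist-splitˡ ab≤ac = cwDist-split (+-mono-≤-< ab≤ac (proj₁ (cwDist-clockwise b∈ c∈)))

  cwDist-splitʳ : cwDist N b c ≤ cwDist N a c → cwDist N a c ≡ cwDist N a b + cwDist N b c
  cwDist-splitʳ bc≤ac = cwDist-split (subst (cwDist N a b + cwDist N b c <_) (+-comm N _)
                                           (+-mono-<-≤ (proj₁ (cwDist-clockwise a∈ b∈)) bc≤ac))

succMod-last : ∀ M → succMod (suc M) (suc M) ≡ 1
succMod-last M = cong suc (n%n≡0 (suc M))

succMod-step : ∀ {N q} → 2 ≤ N → OnCycle N q → OnCycle N (succMod N q) × cwDist N q (succMod N q) ≡ 1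
succMod-step {1} (s≤s ()) _
succMod-step {N@(suc (suc _))} {q} _ (_ , q≤N) with m≤n⇒m<n∨m≡n q≤N
... | inj₁ q<N rewrite m<n⇒m%n≡m q<N = (s≤s z≤n , q<N) , trans (cwDist-≤ (n≤1+n q)) (m+n∸n≡m 1 q)
... | inj₂ refl = subst (λ q⁺ → OnCycle N q⁺ × cwDist N N q⁺ ≡ 1) (sym (succMod-last (N ∸ 1)))
                   ((s≤s z≤n , s≤s z≤n) , trans (cwDist-> {N} {N} {1} (s≤s (s≤s z≤n))) (m+n∸m≡n N 1))

cwDist-succMod : ∀ {N i q} → 2 ≤ N → OnCycle N i → OnCycle N q → suc (cwDist N i q) < N →
                 cwDist N i (succMod N q) ≡ suc (cwDist N i q)
cwDist-succMod {N} {i} {q} 2≤N i∈ q∈ lt = begin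
  cwDist N i (succMod N q)                 ≡⟨ cwDist-split i∈ q∈ q⁺∈ split< ⟩
  cwDist N i q + cwDist N q (succMod N q)  ≡⟨ cong (cwDist N i q +_) q→q⁺ ⟩
  cwDist N i q + 1                         ≡⟨ +-comm (cwDist N i q) 1 ⟩
  suc (cwDist N i q)                       ∎
  where
  open ≡-Reasoning
  q⁺∈ : OnCycle N (succMod N q)
  q⁺∈ = proj₁ (succMod-step 2≤N q∈)
  q→q⁺ : cwDist N q (succMod N q) ≡ 1
  q→q⁺ = proj₂ (succMod-step 2≤N q∈)
  split< : cwDist N i q + cwDist N q (succMod N q) < cwDist N i (succMod N q) + N
  split< rewrite q→q⁺ | +-comm (cwDist N i q) 1 = <-≤-trans lt (m≤n+m N _)

-- Circular intervals

InCirc⇒OnCycle : ∀ {N i j x} → InCirc N i j x → OnCycle N x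
InCirc⇒OnCycle (1≤x , x≤N , _) = 1≤x , x≤N

InCirc⇒cwDist≤ : ∀ {N i j x} → InCirc N i j x → cwDist N i x ≤ cwDist N i j
InCirc⇒cwDist≤ {N} {i} (_ , _ , inj₁ (i≤j , i≤x , x≤j))
  rewrite cwDist-≤ {N} i≤x | cwDist-≤ {N} i≤j = ∸-monoˡ-≤ i x≤j
InCirc⇒cwDist≤ {N} {i} {j} (_ , x≤N , inj₂ (j<i , inj₁ i≤x))
  rewrite cwDist-≤ {N} i≤x | cwDist-> {N} j<i = ∸-monoˡ-≤ i (≤-trans x≤N (m≤m+n N j))
InCirc⇒cwDist≤ {N} {i} (_ , _ , inj₂ (j<i , inj₂ x≤j))
  rewrite cwDist-> {N} (≤-<-trans x≤j j<i) | cwDist-> {N} j<i = ∸-monoˡ-≤ i (+-monoʳ-≤ N x≤j)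

m∸o≤n∸o⇒m≤n : ∀ {m n o} → o ≤ m → o ≤ n → m ∸ o ≤ n ∸ o → m ≤ n
m∸o≤n∸o⇒m≤n {o = o} o≤m o≤n le = subst₂ _≤_ (m+[n∸m]≡n o≤m) (m+[n∸m]≡n o≤n) (+-monoʳ-≤ o le)

cwDist≤⇒InCirc : ∀ {N i j x} → OnCycle N i → OnCycle N j → OnCycle N x →
                 cwDist N i x ≤ cwDist N i j → InCirc N i j x
cwDist≤⇒InCirc {N} {i} {j} {x} (_ , i≤N) (_ , j≤N) (1≤x , x≤N) le with i ≤? j | i ≤? x
... | yes i≤j | yes i≤x = 1≤x , x≤N , inj₁ (i≤j , i≤x , m∸o≤n∸o⇒m≤n i≤x i≤j le)
... | yes i≤j | no  _   =
  contradiction (m∸o≤n∸o⇒m≤n (≤-trans i≤N (m≤m+n N x)) i≤j le) (<⇒≱ (≤-<-trans j≤N (m<m+n N 1≤x)))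
... | no  i≰j | yes i≤x = 1≤x , x≤N , inj₂ (≰⇒> i≰j , inj₁ i≤x)
... | no  i≰j | no  _   = 1≤x , x≤N , inj₂ (≰⇒> i≰j , inj₂ (+-cancelˡ-≤ N x j
        (m∸o≤n∸o⇒m≤n (≤-trans i≤N (m≤m+n N x)) (≤-trans i≤N (m≤m+n N j)) le)))

module _ {N c c′ x y} (c∈ : OnCycle N c) (x∈C : InCirc N c c′ x) (y∈C : InCirc N c c′ y) where
  private
    x∈ : OnCycle N x
    x∈ = InCirc⇒OnCycle x∈C
    y∈ : OnCycle N y
    y∈ = InCirc⇒OnCycle y∈C

  arc-⊆-behind : ∀ {p p′} → OnCycle N p → OnCycle N p′ → InCirc N p p′ x →
                 cwDist N c x ≤ cwDist N p x → cwDist N c y ≤ cwDist N c x → InCirc N p p′ y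
  arc-⊆-behind {p} {p′} p∈ p′∈ x∈P cx≤px cy≤cx = cwDist≤⇒InCirc p∈ p′∈ y∈ py≤pp′
    where
    open ≤-Reasoning
    yx≤px : cwDist N y x ≤ cwDist N p x
    yx≤px = begin
      cwDist N y x                 ≤⟨ m≤n+m _ _ ⟩
      cwDist N c y + cwDist N y x  ≡⟨ cwDist-splitˡ c∈ y∈ x∈ cy≤cx ⟨
      cwDist N c x                 ≤⟨ cx≤px ⟩
      cwDist N p x                 ∎
    py≤pp′ : cwDist N p y ≤ cwDist N p p′
    py≤pp′ = begin
      cwDist N p y                 ≤⟨ m≤m+n _ _ ⟩
      cwDist N p y + cwDist N y x  ≡⟨ cwDist-splitʳ p∈ y∈ x∈ yx≤px ⟨
      cwDist N p x                 ≤⟨ InCirc⇒cwDist≤ x∈P ⟩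
      cwDist N p p′                ∎

  arc-⊆-ahead : ∀ {q q′} → OnCycle N c′ → OnCycle N q → OnCycle N q′ → InCirc N q q′ x →
                cwDist N x c′ ≤ cwDist N x q′ → cwDist N c x ≤ cwDist N c y → InCirc N q q′ y
  arc-⊆-ahead {q} {q′} c′∈ q∈ q′∈ x∈Q xc′≤xq′ cx≤cy = cwDist≤⇒InCirc q∈ q′∈ y∈ qy≤qq′
    where
    open ≤-Reasoning
    xy≤xc′ : cwDist N x y ≤ cwDist N x c′
    xy≤xc′ = +-cancelˡ-≤ (cwDist N c x) _ _ (begin
      cwDist N c x + cwDist N x y   ≡⟨ cwDist-splitˡ c∈ x∈ y∈ cx≤cy ⟨
      cwDist N c y                  ≤⟨ InCirc⇒cwDist≤ y∈C ⟩
      cwDist N c c′                 ≡⟨ cwDist-splitˡ c∈ x∈ c′∈ (InCirc⇒cwDist≤ x∈C) ⟩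
      cwDist N c x + cwDist N x c′  ∎)
    qx+xy≤qq′ : cwDist N q x + cwDist N x y ≤ cwDist N q q′
    qx+xy≤qq′ = begin
      cwDist N q x + cwDist N x y   ≤⟨ +-monoʳ-≤ (cwDist N q x) (≤-trans xy≤xc′ xc′≤xq′) ⟩
      cwDist N q x + cwDist N x q′  ≡⟨ cwDist-splitˡ q∈ x∈ q′∈ (InCirc⇒cwDist≤ x∈Q) ⟨
      cwDist N q q′                 ∎
    qx+xy<qy+N : cwDist N q x + cwDist N x y < cwDist N q y + N
    qx+xy<qy+N = <-≤-trans (≤-<-trans qx+xy≤qq′ (proj₁ (cwDist-clockwise q∈ q′∈))) (m≤n+m N _)
    qy≤qq′ : cwDist N q y ≤ cwDist N q q′
    qy≤qq′ = begin
      cwDist N q y                  ≡⟨ cwDist-split q∈ x∈ y∈ qx+xy<qy+N ⟩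
      cwDist N q x + cwDist N x y   ≤⟨ qx+xy≤qq′ ⟩
      cwDist N q q′                 ∎

arc-⊆-∪ : ∀ {N c c′ p p′ q q′ x} →
          OnCycle N c → OnCycle N c′ → OnCycle N p → OnCycle N p′ → OnCycle N q → OnCycle N q′ →
          InCirc N c c′ x → InCirc N p p′ x → InCirc N q q′ x →
          cwDist N c x ≤ cwDist N p x → cwDist N x c′ ≤ cwDist N x q′ →
          ∀ {y} → InCirc N c c′ y → InCirc N p p′ y ⊎ InCirc N q q′ y
arc-⊆-∪ {N} {c} {x = x} c∈ c′∈ p∈ p′∈ q∈ q′∈ x∈C x∈P x∈Q cx≤px xc′≤xq′ {y} y∈C
  with ≤-total (cwDist N c y) (cwDist N c x)
... | inj₁ cy≤cx = inj₁ (arc-⊆-behind c∈ x∈C y∈C p∈ p′∈ x∈P cx≤px cy≤cx)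
... | inj₂ cx≤cy = inj₂ (arc-⊆-ahead c∈ x∈C y∈C c′∈ q∈ q′∈ x∈Q xc′≤xq′ cx≤cy)

module _ {A : Set} (Good : A → Set) (l r : A → ℕ)
         (undominated : ∀ {c p q} → Good c → Good p → Good q → p ≢ c → q ≢ c →
                        l c ≤ l p → r c ≤ r q → ⊥) where
  private
    l-maximal : ∀ {m u w} → Good m → Good u → Good w → u ≢ w → u ≢ m → w ≢ m →
                l u ≤ l m → l w ≤ l m → ⊥
    l-maximal {m} {u} {w} gm gu gw u≢w u≢m w≢m lu≤lm lw≤lm with ≤-total (r u) (r w)
    ... | inj₁ ru≤rw = undominated gu gm gw (u≢m ∘ sym) (u≢w ∘ sym) lu≤lm ru≤rw
    ... | inj₂ rw≤ru = undominated gw gm gu (w≢m ∘ sym) u≢w lw≤lm rw≤ru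

  no-three-undominated : ∀ {x y z} → Good x → Good y → Good z → x ≢ y → x ≢ z → y ≢ z → ⊥
  no-three-undominated {x} {y} {z} gx gy gz x≢y x≢z y≢z with ≤-total (l x) (l y)
  ... | inj₁ lx≤ly with ≤-total (l y) (l z)
  ...   | inj₁ ly≤lz = l-maximal gz gx gy x≢y x≢z y≢z (≤-trans lx≤ly ly≤lz) ly≤lz
  ...   | inj₂ lz≤ly = l-maximal gy gx gz x≢z x≢y (y≢z ∘ sym) lx≤ly lz≤ly
  no-three-undominated {x} {y} {z} gx gy gz x≢y x≢z y≢z | inj₂ ly≤lx with ≤-total (l x) (l z)
  ...   | inj₁ lx≤lz = l-maximal gz gx gy x≢y x≢z y≢z lx≤lz (≤-trans ly≤lx lx≤lz)
  ...   | inj₂ lz≤lx = l-maximal gx gy gz y≢z (x≢y ∘ sym) (x≢z ∘ sym) ly≤lx lz≤lx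

-- Motion of a single agent

module Agents {n N} (2≤N : 2 ≤ N) {v : ℕ → Fin n} {G : ℕ → Graph n} {s : ℕ → ℕ → ℕ} {A : ℕ → ℕ → Bool}
              (run : IsRun N v G s A) where

  open IsRun run

  moves : ℕ → ℕ → Bool
  moves τ q = adj (G (suc τ)) (v q) (v (suc q))

  Arrival : ℕ → ℕ → Set
  Arrival i zero    = ⊤
  Arrival i (suc τ) = moves τ (s i τ) ≡ true

  offset : ℕ → ℕ → ℕ
  offset i τ = cwDist N i (s i τ)

  module _ {i} (i∈ : OnCycle N i) where

    s-suc : ∀ {τ} → suc τ ≤ N → s i (suc τ) ≡ (if moves τ (s i τ) then succMod N (s i τ) else s i τ)
    s-suc {τ} le = move (suc τ) (s≤s z≤n) le i (proj₁ i∈) (proj₂ i∈)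

    s-suc-moves : ∀ {τ} → suc τ ≤ N → moves τ (s i τ) ≡ true → s i (suc τ) ≡ succMod N (s i τ)
    s-suc-moves {τ} le eq = trans (s-suc le) (cong (if_then succMod N (s i τ) else s i τ) eq)

    s-suc-stays : ∀ {τ} → suc τ ≤ N → moves τ (s i τ) ≡ false → s i (suc τ) ≡ s i τ
    s-suc-stays {τ} le eq = trans (s-suc le) (cong (if_then succMod N (s i τ) else s i τ) eq)

    position-onCycle : ∀ {τ} → τ < N → OnCycle N (s i τ)
    offset-≤ : ∀ {τ} → τ < N → offset i τ ≤ τ
    offset-moves : ∀ {τ} → suc τ < N → moves τ (s i τ) ≡ true → offset i (suc τ) ≡ suc (offset i τ)

    position-onCycle {zero} _ rewrite s-init i (proj₁ i∈) (proj₂ i∈) = i∈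
    position-onCycle {suc τ} lt with moves τ (s i τ) in eq
    ... | true  rewrite s-suc-moves (<⇒≤ lt) eq = proj₁ (succMod-step 2≤N (position-onCycle (<⇒≤ lt)))
    ... | false rewrite s-suc-stays (<⇒≤ lt) eq = position-onCycle (<⇒≤ lt)

    offset-≤ {zero} _ rewrite s-init i (proj₁ i∈) (proj₂ i∈) = ≤-reflexive (cwDist-self i)
    offset-≤ {suc τ} lt with moves τ (s i τ) in eq
    ... | true  rewrite offset-moves lt eq = s≤s (offset-≤ (<⇒≤ lt))
    ... | false rewrite s-suc-stays (<⇒≤ lt) eq = m≤n⇒m≤1+n (offset-≤ (<⇒≤ lt))

    offset-moves lt eq rewrite s-suc-moves (<⇒≤ lt) eq =
      cwDist-succMod 2≤N i∈ (position-onCycle (<⇒≤ lt)) (≤-<-trans (s≤s (offset-≤ (<⇒≤ lt))) lt)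

    offset-≤-suc : ∀ {τ} → suc τ < N → offset i τ ≤ offset i (suc τ)
    offset-≤-suc {τ} lt with moves τ (s i τ) in eq
    ... | true  rewrite offset-moves lt eq = n≤1+n _
    ... | false rewrite s-suc-stays (<⇒≤ lt) eq = ≤-refl

    offset-mono : ∀ {τ₁ τ₂} → τ₁ ≤ τ₂ → τ₂ < N → offset i τ₁ ≤ offset i τ₂
    offset-mono {τ₂ = zero}   z≤n _ = ≤-refl
    offset-mono {τ₂ = suc τ₂} le lt with m≤n⇒m<n∨m≡n le
    ... | inj₂ refl      = ≤-refl
    ... | inj₁ (s≤s le′) = ≤-trans (offset-mono le′ (<⇒≤ lt)) (offset-≤-suc lt)

    position-∈-arc : ∀ {τ t} → τ ≤ t → t < N → InCirc N i (s i t) (s i τ)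
    position-∈-arc le lt =
      cwDist≤⇒InCirc i∈ (position-onCycle lt) (position-onCycle (≤-<-trans le lt)) (offset-mono le lt)

    earlier≢arrival : ∀ {τ₁ τ₂} → τ₁ < τ₂ → τ₂ < N → Arrival i τ₂ → s i τ₁ ≢ s i τ₂
    earlier≢arrival {τ₁} {suc τ} (s≤s τ₁≤τ) lt moved e = <-irrefl (cong (cwDist N i) e) (begin-strict
      offset i τ₁       ≤⟨ offset-mono τ₁≤τ (<⇒≤ lt) ⟩
      offset i τ        <⟨ n<1+n _ ⟩
      suc (offset i τ)  ≡⟨ offset-moves lt moved ⟨
      offset i (suc τ)  ∎)
      where open ≤-Reasoning

    arrival-injective : ∀ {τ₁ τ₂} → τ₁ < N → τ₂ < N → Arrival i τ₁ → Arrival i τ₂ →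
                        s i τ₁ ≡ s i τ₂ → τ₁ ≡ τ₂
    arrival-injective {τ₁} {τ₂} lt₁ lt₂ a₁ a₂ e with <-cmp τ₁ τ₂
    ... | tri≈ _ τ₁≡τ₂ _ = τ₁≡τ₂
    ... | tri< τ₁<τ₂ _ _ = contradiction e (earlier≢arrival τ₁<τ₂ lt₂ a₂)
    ... | tri> _ _ τ₂<τ₁ = contradiction (sym e) (earlier≢arrival τ₂<τ₁ lt₁ a₁)

  same-position-later : ∀ {i j τ τ′} → OnCycle N i → OnCycle N j → τ ≤ τ′ → τ′ ≤ N →
                        s i τ ≡ s j τ → s i τ′ ≡ s j τ′
  same-position-later {τ′ = zero} _ _ z≤n _ e = e
  same-position-later {i} {j} {τ′ = suc τ′} i∈ j∈ le le′ e with m≤n⇒m<n∨m≡n le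
  ... | inj₂ refl      = e
  ... | inj₁ (s≤s le″) = begin
    s i (suc τ′)   ≡⟨ s-suc i∈ le′ ⟩
    next (s i τ′)  ≡⟨ cong next (same-position-later i∈ j∈ le″ (<⇒≤ le′) e) ⟩
    next (s j τ′)  ≡⟨ s-suc j∈ le′ ⟨
    s j (suc τ′)   ∎
    where
    open ≡-Reasoning
    next : ℕ → ℕ
    next q = if moves τ′ q then succMod N q else q

-- Edges of the tour

edgeKey : ∀ {n} → Fin n → Fin n → Fin n × Fin n
edgeKey a b with toℕ a <? toℕ b
... | yes _ = a , b
... | no  _ = b , a

module _ {n} {a b u w : Fin n} where

  edgeKey-sameEdge : edgeKey a b ≡ (u , w) → sameEdge a b u w ≡ true
  edgeKey-sameEdge e with toℕ a <? toℕ b | e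
  ... | yes _ | refl rewrite dec-true (a ≟ᶠ a) refl | dec-true (b ≟ᶠ b) refl = refl
  ... | no  _ | refl rewrite dec-true (a ≟ᶠ a) refl | dec-true (b ≟ᶠ b) refl = ∨-zeroʳ _

  edgeKey-adj : (H : Graph n) → edgeKey a b ≡ (u , w) → adj H a b ≡ adj H u w
  edgeKey-adj H e with toℕ a <? toℕ b | e
  ... | yes _ | refl = refl
  ... | no  _ | refl = Graph.sym H a b

missingEdgeList : ∀ {n} → Graph n → Graph n → List (Fin n × Fin n)
missingEdgeList {n} T H =
  filterᵇ (λ p → adj T (proj₁ p) (proj₂ p) ∧ not (adj H (proj₁ p) (proj₂ p))) (unorderedPairs n)

∈-unorderedPairs : ∀ {n} {a b : Fin n} → toℕ a < toℕ b → (a , b) ∈ unorderedPairs n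
∈-unorderedPairs {n} {a} {b} a<b = ∈-filter⁺ _
  (∈-concatMap⁺ (λ u → map (u ,_) (allFin n)) (lose (∈-allFin a) (∈-map⁺ (a ,_) (∈-allFin b))))
  (≤⇒≤ᵇ a<b)

edgeKey∈missingEdgeList : ∀ {n} (T H : Graph n) {a b} → Adj T a b → adj H a b ≡ false →
                          edgeKey a b ∈ missingEdgeList T H
edgeKey∈missingEdgeList T H {a} {b} ab∈T ab∉H with toℕ a <? toℕ b
... | yes a<b = ∈-filter⁺ _ (∈-unorderedPairs a<b) (Equivalence.from T-≡ (cong₂ (λ x y → x ∧ not y) ab∈T ab∉H))
... | no  a≮b = ∈-filter⁺ _ (∈-unorderedPairs b<a) (Equivalence.from T-≡ (cong₂ (λ x y → x ∧ not y) ba∈T ba∉H))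
  where
  ba∈T : Adj T b a
  ba∈T = trans (Graph.sym T b a) ab∈T
  ba∉H : adj H b a ≡ false
  ba∉H = trans (Graph.sym H b a) ab∉H
  a≢b : a ≢ b
  a≢b refl = contradiction (trans (sym ab∈T) (Graph.irrefl T a)) λ ()
  b<a : toℕ b < toℕ a
  b<a = ≤∧≢⇒< (≮⇒≥ a≮b) (a≢b ∘ sym ∘ toℕ-injective)

OnCycle⇒∈range1 : ∀ {N x} → OnCycle N x → x ∈ range1 N
OnCycle⇒∈range1 {x = suc _} (_ , x≤N) = ∈-map⁺ suc (∈-upTo⁺ x≤N)

∈range1⇒OnCycle : ∀ {N x} → x ∈ range1 N → OnCycle N x
∈range1⇒OnCycle x∈ with ∈-map⁻ suc x∈
... | _ , y∈ , refl = s≤s z≤n , ∈-upTo⁻ y∈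

length-range1 : ∀ N → length (range1 N) ≡ N
length-range1 N = trans (length-map suc (upTo N)) (length-upTo N)

module _ {A : Set} where

  ∈⇒1≤length : ∀ {x : A} {xs} → x ∈ xs → 1 ≤ length xs
  ∈⇒1≤length (here _)  = s≤s z≤n
  ∈⇒1≤length (there _) = s≤s z≤n

  distinct⇒2≤length : ∀ {x y : A} {xs} → x ∈ xs → y ∈ xs → x ≢ y → 2 ≤ length xs
  distinct⇒2≤length (here refl) (here refl) x≢y = contradiction refl x≢y
  distinct⇒2≤length (here refl) (there y∈)  _   = s≤s (∈⇒1≤length y∈)
  distinct⇒2≤length (there x∈)  (here refl) _   = s≤s (∈⇒1≤length x∈)
  distinct⇒2≤length (there x∈)  (there y∈)  x≢y = m≤n⇒m≤1+n (distinct⇒2≤length x∈ y∈ x≢y)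

  distinct⇒3≤length : ∀ {x y z : A} {xs} → x ∈ xs → y ∈ xs → z ∈ xs → x ≢ y → x ≢ z → y ≢ z →
                      3 ≤ length xs
  distinct⇒3≤length (here refl) (here refl) _           x≢y _   _   = contradiction refl x≢y
  distinct⇒3≤length (here refl) (there _)   (here refl) _   x≢z _   = contradiction refl x≢z
  distinct⇒3≤length (here refl) (there y∈)  (there z∈)  _   _   y≢z = s≤s (distinct⇒2≤length y∈ z∈ y≢z)
  distinct⇒3≤length (there _)   (here refl) (here refl) _   _   y≢z = contradiction refl y≢z
  distinct⇒3≤length (there x∈)  (here refl) (there z∈)  _   x≢z _   = s≤s (distinct⇒2≤length x∈ z∈ x≢z)
  distinct⇒3≤length (there x∈)  (there y∈)  (here refl) x≢y _   _   = s≤s (distinct⇒2≤length x∈ y∈ x≢y)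
  distinct⇒3≤length (there x∈)  (there y∈)  (there z∈)  x≢y x≢z y≢z =
    m≤n⇒m≤1+n (distinct⇒3≤length x∈ y∈ z∈ x≢y x≢z y≢z)

module _ {n} {T : Graph n} {r N v} (tour : IsDFSTour T r N v) where
  open IsDFSTour tour

  no-three-traversals : ∀ {q₁ q₂ q₃ e} → OnCycle N q₁ → OnCycle N q₂ → OnCycle N q₃ →
                        q₁ ≢ q₂ → q₁ ≢ q₃ → q₂ ≢ q₃ →
                        edgeKey (v q₁) (v (suc q₁)) ≡ e → edgeKey (v q₂) (v (suc q₂)) ≡ e →
                        edgeKey (v q₃) (v (suc q₃)) ≡ e → ⊥
  no-three-traversals {q₁} {e = u , w} q₁∈ q₂∈ q₃∈ q₁≢q₂ q₁≢q₃ q₂≢q₃ k₁ k₂ k₃ =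
    <⇒≱ (n<1+n 2) (subst (3 ≤_) (twice u w uw∈T)
      (distinct⇒3≤length (traversal q₁∈ k₁) (traversal q₂∈ k₂) (traversal q₃∈ k₃) q₁≢q₂ q₁≢q₃ q₂≢q₃))
    where
    traversal : ∀ {q} → OnCycle N q → edgeKey (v q) (v (suc q)) ≡ (u , w) →
                q ∈ filterᵇ (λ i → sameEdge (v i) (v (suc i)) u w) (range1 N)
    traversal q∈ k = ∈-filter⁺ _ (OnCycle⇒∈range1 q∈) (Equivalence.from T-≡ (edgeKey-sameEdge k))
    uw∈T : Adj T u w
    uw∈T = trans (sym (edgeKey-adj T k₁)) (walk q₁ (proj₁ q₁∈) (proj₂ q₁∈))

-- Counting through an at most two-to-one map

length-filter+length-filter-∁ : ∀ {A : Set} {P : A → Set} (P? : Decidable P) xs →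
                                length (filter P? xs) + length (filter (∁? P?) xs) ≡ length xs
length-filter+length-filter-∁ P? []       = refl
length-filter+length-filter-∁ P? (x ∷ xs) with does (P? x)
... | true  = cong suc (length-filter+length-filter-∁ P? xs)
... | false = trans (+-suc _ _) (cong suc (length-filter+length-filter-∁ P? xs))

length-cartesianProduct : ∀ {A B : Set} (xs : List A) (ys : List B) →
                          length (cartesianProduct xs ys) ≡ length xs * length ys
length-cartesianProduct []       ys = refl
length-cartesianProduct (x ∷ xs) ys =
  trans (length-++ (map (x ,_) ys)) (cong₂ _+_ (length-map (x ,_) ys) (length-cartesianProduct xs ys))

module _ {A B : Set} (f : A → B) where

  AtMostTwoToOne : List A → Set
  AtMostTwoToOne L = ∀ {u x y z} → x ∈ L → y ∈ L → z ∈ L → x ≢ y → x ≢ z → y ≢ z →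
                     f x ≡ u → f y ≡ u → f z ≡ u → ⊥

  AtMostTwoToOne-⊆ : ∀ {L L′} → (∀ {x} → x ∈ L′ → x ∈ L) → AtMostTwoToOne L → AtMostTwoToOne L′
  AtMostTwoToOne-⊆ L′⊆L twoToOne x∈ y∈ z∈ = twoToOne (L′⊆L x∈) (L′⊆L y∈) (L′⊆L z∈)

  fibre-length≤2 : ∀ {u xs} → AtMostTwoToOne xs → Unique xs → (∀ {x} → x ∈ xs → f x ≡ u) → length xs ≤ 2
  fibre-length≤2 {xs = []}              _ _ _ = z≤n
  fibre-length≤2 {xs = _ ∷ []}          _ _ _ = s≤s z≤n
  fibre-length≤2 {xs = _ ∷ _ ∷ []}      _ _ _ = s≤s (s≤s z≤n)
  fibre-length≤2 {xs = xs@(x ∷ y ∷ z ∷ _)} twoToOne ((x≢y ∷ x≢z ∷ _) ∷ (y≢z ∷ _) ∷ _) fibre =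
    ⊥-elim (twoToOne x∈ y∈ z∈ x≢y x≢z y≢z (fibre x∈) (fibre y∈) (fibre z∈))
    where
    x∈ : x ∈ xs
    x∈ = here refl
    y∈ : y ∈ xs
    y∈ = there (here refl)
    z∈ : z ∈ xs
    z∈ = there (there (here refl))

  length≤2*length : DecidableEquality B → ∀ {L U} → Unique L → (∀ {x} → x ∈ L → f x ∈ U) →
                    AtMostTwoToOne L → length L ≤ 2 * length U
  length≤2*length _≟_ {[]}    _ _ _ = z≤n
  length≤2*length _≟_ {_ ∷ _} {[]} _ f∈U _ with () ← f∈U (here refl)
  length≤2*length _≟_ {L} {u ∷ U} L! f∈U twoToOne = begin
    length L                    ≡⟨ length-filter+length-filter-∁ ∈fibre? L ⟨
    length fibre + length rest  ≤⟨ +-mono-≤ fibre≤2 rest≤ ⟩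
    2 + 2 * length U            ≡⟨ *-suc 2 (length U) ⟨
    2 * length (u ∷ U)          ∎
    where
    open ≤-Reasoning
    ∈fibre? : Decidable (λ x → f x ≡ u)
    ∈fibre? x = f x ≟ u
    fibre rest : List A
    fibre = filter ∈fibre? L
    rest  = filter (∁? ∈fibre?) L
    fibre≤2 : length fibre ≤ 2
    fibre≤2 = fibre-length≤2 (AtMostTwoToOne-⊆ (proj₁ ∘ ∈-filter⁻ ∈fibre? {xs = L}) twoToOne)
                             (filter⁺ ∈fibre? L!) (proj₂ ∘ ∈-filter⁻ ∈fibre? {xs = L})
    rest→U : ∀ {x} → x ∈ rest → f x ∈ U
    rest→U x∈ with ∈-filter⁻ (∁? ∈fibre?) x∈
    ... | x∈L , fx≢u with f∈U x∈L
    ...   | here fx≡u  = contradiction fx≡u fx≢u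
    ...   | there fx∈U = fx∈U
    rest≤ : length rest ≤ 2 * length U
    rest≤ = length≤2*length _≟_ (filter⁺ (∁? ∈fibre?) L!) rest→U
              (AtMostTwoToOne-⊆ (proj₁ ∘ ∈-filter⁻ (∁? ∈fibre?) {xs = L}) twoToOne)

-- The survivors at time t₀

module Counting {n N k} (2≤N : 2 ≤ N) {T : Graph n} {r : Fin n} {v : ℕ → Fin n} (tour : IsDFSTour T r N v)
                {G : ℕ → Graph n} (few-missing : ∀ t → 1 ≤ t → t ≤ N → missingEdges T (G t) ≤ k)
                {s : ℕ → ℕ → ℕ} {A : ℕ → ℕ → Bool} (run : IsRun N v G s A)
                {t₀} (1≤t₀ : 1 ≤ t₀) (t₀<N : t₀ < N) where

  open Agents 2≤N run
  open IsRun run using (done)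
  open IsDFSTour tour using (walk)

  Survivor : ℕ → Set
  Survivor i = OnCycle N i × A t₀ i ≡ true

  end : ℕ → ℕ
  end i = s i t₀

  end-onCycle : ∀ {i} → OnCycle N i → OnCycle N (end i)
  end-onCycle i∈ = position-onCycle i∈ t₀<N

  end∈arc : ∀ {i} → OnCycle N i → InCirc N i (end i) (end i)
  end∈arc i∈ = position-∈-arc i∈ ≤-refl t₀<N

  uncovered : ∀ {c} → Survivor c → ¬ Covered N end (A t₀) c
  uncovered (_ , c!) = done t₀ 1≤t₀ (<⇒≤ t₀<N) _ c!

  covered : ∀ {c p q x} → Survivor c → Survivor p → Survivor q → p ≢ c → q ≢ c →
            InCirc N c (end c) x → InCirc N p (end p) x → InCirc N q (end q) x →
            cwDist N c x ≤ cwDist N p x → cwDist N x (end c) ≤ cwDist N x (end q) →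
            Covered N end (A t₀) c
  covered (c∈ , _) (p∈ , p!) (q∈ , q!) p≢c q≢c x∈C x∈P x∈Q behind ahead _ y∈C
    with arc-⊆-∪ c∈ (end-onCycle c∈) p∈ (end-onCycle p∈) q∈ (end-onCycle q∈) x∈C x∈P x∈Q behind ahead y∈C
  ... | inj₁ y∈P = _ , p! , p≢c , y∈P
  ... | inj₂ y∈Q = _ , q! , q≢c , y∈Q

  no-three-survivors-through : ∀ {a b c x} → Survivor a → Survivor b → Survivor c → a ≢ b → a ≢ c → b ≢ c →
                               InCirc N a (end a) x → InCirc N b (end b) x → InCirc N c (end c) x → ⊥
  no-three-survivors-through {x = x} sa sb sc a≢b a≢c b≢c x∈A x∈B x∈C =
    no-three-undominated (λ i → Survivor i × InCirc N i (end i) x)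
                         (λ i → cwDist N i x) (λ i → cwDist N x (end i))
      (λ (sc , x∈C) (sp , x∈P) (sq , x∈Q) p≢c q≢c behind ahead →
         uncovered sc (covered sc sp sq p≢c q≢c x∈C x∈P x∈Q behind ahead))
      (sa , x∈A) (sb , x∈B) (sc , x∈C) a≢b a≢c b≢c

  shorter-arc-covered : ∀ {a b} → Survivor a → Survivor b → b ≢ a → end a ≡ end b →
                        cwDist N a (end a) ≤ cwDist N b (end a) → Covered N end (A t₀) a
  shorter-arc-covered {a} {b} sa sb b≢a e shorter =
    covered sa sb sb b≢a b≢a (end∈arc (proj₁ sa)) x∈B x∈B shorter (≤-reflexive (cong (cwDist N (end a)) e))
    where
    x∈B : InCirc N b (end b) (end a)
    x∈B = subst (InCirc N b (end b)) (sym e) (end∈arc (proj₁ sb))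

  survivors-distinct-ends : ∀ {a b} → Survivor a → Survivor b → a ≢ b → end a ≢ end b
  survivors-distinct-ends {a} {b} sa sb a≢b e with ≤-total (cwDist N a (end a)) (cwDist N b (end a))
  ... | inj₁ a-shorter = uncovered sa (shorter-arc-covered sa sb (a≢b ∘ sym) e a-shorter)
  ... | inj₂ b-shorter = uncovered sb (shorter-arc-covered sb sa a≢b (sym e)
                           (subst (λ z → cwDist N b z ≤ cwDist N a z) e b-shorter))

  survivors-distinct-positions : ∀ {i j τ} → Survivor i → Survivor j → τ ≤ t₀ → i ≢ j → s i τ ≢ s j τ
  survivors-distinct-positions si sj τ≤t₀ i≢j e =
    survivors-distinct-ends si sj i≢j (same-position-later (proj₁ si) (proj₁ sj) τ≤t₀ (<⇒≤ t₀<N) e)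

  Event : Set
  Event = ℕ ⊎ (ℕ × (Fin n × Fin n))

  tourEdge : ℕ → Fin n × Fin n
  tourEdge q = edgeKey (v q) (v (suc q))

  event : ℕ × ℕ → Event
  event (i , zero)  = inj₁ (s i 0)
  event (i , suc τ) = if moves τ (s i τ) then inj₁ (s i (suc τ)) else inj₂ (suc τ , tourEdge (s i τ))

  event-arrival : ∀ {i τ p} → event (i , τ) ≡ inj₁ p → Arrival i τ × s i τ ≡ p
  event-arrival {τ = zero} refl = tt , refl
  event-arrival {i} {suc τ} e with moves τ (s i τ)
  ... | true  = refl , ⊎.inj₁-injective e
  ... | false with () ← e

  event-blocked : ∀ {i τ t e} → event (i , τ) ≡ inj₂ (t , e) →
                  ∃[ t′ ] t ≡ suc t′ × τ ≡ t × moves t′ (s i t′) ≡ false × tourEdge (s i t′) ≡ e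
  event-blocked {i} {suc τ} e with moves τ (s i τ) in stays
  ... | false with refl ← e = τ , refl , refl , stays , refl
  ... | true  with () ← e

  survivors : List ℕ
  survivors = filterᵇ (A t₀) (range1 N)

  domain : List (ℕ × ℕ)
  domain = cartesianProduct survivors (upTo (suc t₀))

  ∈domain : ∀ {i τ} → (i , τ) ∈ domain → Survivor i × τ ≤ t₀
  ∈domain x∈ with ∈-cartesianProduct⁻ survivors (upTo (suc t₀)) x∈
  ... | i∈ , τ∈ with ∈-filter⁻ (T? ∘ A t₀) {xs = range1 N} i∈
  ...   | i∈range , i! = (∈range1⇒OnCycle i∈range , Equivalence.to T-≡ i!) , ≤-pred (∈-upTo⁻ τ∈)

  domain-unique : Unique domain
  domain-unique = cartesianProduct⁺ (filter⁺ (T? ∘ A t₀) (map⁺ suc-injective (upTo⁺ N))) (upTo⁺ (suc t₀))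

  length-domain : length domain ≡ countIn N (A t₀) * suc t₀
  length-domain = trans (length-cartesianProduct survivors (upTo (suc t₀)))
                        (cong (countIn N (A t₀) *_) (length-upTo (suc t₀)))

  blockedEvents : ℕ → List Event
  blockedEvents zero    = []
  blockedEvents (suc t) = map (λ e → inj₂ (suc t , e)) (missingEdgeList T (G (suc t))) ++ blockedEvents t

  length-blockedEvents : ∀ {t} → t ≤ N → length (blockedEvents t) ≤ t * k
  length-blockedEvents {zero}  _  = z≤n
  length-blockedEvents {suc t} le = begin
    length (blockedEvents (suc t))                         ≡⟨ length-++ (map _ missing) ⟩
    length (map _ missing) + length (blockedEvents t)      ≡⟨ cong₂ _+_ (length-map _ missing) refl ⟩
    missingEdges T (G (suc t)) + length (blockedEvents t)  ≤⟨ +-mono-≤ (few-missing (suc t) (s≤s z≤n) le)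
                                                                       (length-blockedEvents (<⇒≤ le)) ⟩
    k + t * k                                              ∎
    where
    open ≤-Reasoning
    missing : List (Fin n × Fin n)
    missing = missingEdgeList T (G (suc t))

  ∈blockedEvents : ∀ {t τ e} → suc τ ≤ t → e ∈ missingEdgeList T (G (suc τ)) →
                   inj₂ (suc τ , e) ∈ blockedEvents t
  ∈blockedEvents {suc t} le e∈ with m≤n⇒m<n∨m≡n le
  ... | inj₂ refl      = ∈-++⁺ˡ (∈-map⁺ _ e∈)
  ... | inj₁ (s≤s le′) = ∈-++⁺ʳ _ (∈blockedEvents le′ e∈)

  codomain : List Event
  codomain = map inj₁ (range1 N) ++ blockedEvents t₀

  length-codomain : length codomain ≤ N + t₀ * k
  length-codomain = begin
    length codomain                                           ≡⟨ length-++ (map inj₁ (range1 N)) ⟩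
    length (map inj₁ (range1 N)) + length (blockedEvents t₀)  ≡⟨ cong₂ _+_ (length-map inj₁ (range1 N)) refl ⟩
    length (range1 N) + length (blockedEvents t₀)             ≡⟨ cong₂ _+_ (length-range1 N) refl ⟩
    N + length (blockedEvents t₀)                             ≤⟨ +-monoʳ-≤ N (length-blockedEvents (<⇒≤ t₀<N)) ⟩
    N + t₀ * k                                                ∎
    where open ≤-Reasoning

  event-∈-codomain : ∀ {x} → x ∈ domain → event x ∈ codomain
  event-∈-codomain {i , τ} x∈ with ∈domain x∈ | event (i , τ) in ev
  ... | (i∈ , _) , τ≤t₀ | inj₁ p with event-arrival {i} {τ} ev
  ...   | _ , refl = ∈-++⁺ˡ (∈-map⁺ inj₁ (OnCycle⇒∈range1 (position-onCycle i∈ (≤-<-trans τ≤t₀ t₀<N))))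
  event-∈-codomain {i , τ} x∈ | (i∈ , _) , τ≤t₀ | inj₂ (t , e) with event-blocked {i} {τ} ev
  ...   | t′ , refl , refl , stays , refl =
    ∈-++⁺ʳ _ (∈blockedEvents τ≤t₀ (edgeKey∈missingEdgeList T (G (suc t′)) (walk _ (proj₁ q∈) (proj₂ q∈)) stays))
    where
    q∈ : OnCycle N (s i t′)
    q∈ = position-onCycle i∈ (<⇒≤ (≤-<-trans τ≤t₀ t₀<N))

  arrival-∈-arc : ∀ {i τ p} → (i , τ) ∈ domain → event (i , τ) ≡ inj₁ p → InCirc N i (end i) p
  arrival-∈-arc {i} {τ} x∈ ex with ∈domain x∈ | event-arrival {i} {τ} ex
  ... | (i∈ , _) , τ≤t₀ | _ , refl = position-∈-arc i∈ τ≤t₀ t₀<N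

  arrivals-distinct-agents : ∀ {i τ j τ′ p} → (i , τ) ∈ domain → (j , τ′) ∈ domain → (i , τ) ≢ (j , τ′) →
                             event (i , τ) ≡ inj₁ p → event (j , τ′) ≡ inj₁ p → i ≢ j
  arrivals-distinct-agents {i} {τ} {_} {τ′} x∈ y∈ x≢y ex ey refl
    with ∈domain x∈ | ∈domain y∈ | event-arrival {i} {τ} ex | event-arrival {i} {τ′} ey
  ... | (i∈ , _) , τ≤t₀ | _ , τ′≤t₀ | a , refl | a′ , e′ =
    x≢y (cong (i ,_) (arrival-injective i∈ (≤-<-trans τ≤t₀ t₀<N) (≤-<-trans τ′≤t₀ t₀<N) a a′ (sym e′)))

  events-two-to-one : AtMostTwoToOne event domain
  events-two-to-one {inj₁ p} x∈ y∈ z∈ x≢y x≢z y≢z ex ey ez =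
    no-three-survivors-through (proj₁ (∈domain x∈)) (proj₁ (∈domain y∈)) (proj₁ (∈domain z∈))
      (arrivals-distinct-agents x∈ y∈ x≢y ex ey) (arrivals-distinct-agents x∈ z∈ x≢z ex ez)
      (arrivals-distinct-agents y∈ z∈ y≢z ey ez)
      (arrival-∈-arc x∈ ex) (arrival-∈-arc y∈ ey) (arrival-∈-arc z∈ ez)
  events-two-to-one {inj₂ (t , e)} {i₁ , τ₁} {i₂ , τ₂} {i₃ , τ₃} x∈ y∈ z∈ x≢y x≢z y≢z ex ey ez
    with event-blocked {i₁} {τ₁} ex | event-blocked {i₂} {τ₂} ey | event-blocked {i₃} {τ₃} ez
  ... | t′ , refl , refl , _ , k₁ | _ , refl , refl , _ , k₂ | _ , refl , refl , _ , k₃ =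
    no-three-traversals tour (position∈ x∈) (position∈ y∈) (position∈ z∈)
      (distinct x∈ y∈ x≢y) (distinct x∈ z∈ x≢z) (distinct y∈ z∈ y≢z) k₁ k₂ k₃
    where
    position∈ : ∀ {i} → (i , suc t′) ∈ domain → OnCycle N (s i t′)
    position∈ x∈ = position-onCycle (proj₁ (proj₁ (∈domain x∈))) (<⇒≤ (≤-<-trans (proj₂ (∈domain x∈)) t₀<N))
    distinct : ∀ {i j} → (i , suc t′) ∈ domain → (j , suc t′) ∈ domain → (i , suc t′) ≢ (j , suc t′) →
               s i t′ ≢ s j t′
    distinct x∈ y∈ x≢y = survivors-distinct-positions (proj₁ (∈domain x∈)) (proj₁ (∈domain y∈))
      (≤-trans (n≤1+n t′) (proj₂ (∈domain x∈))) (x≢y ∘ cong (_, suc t′))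

  survivors-bound : countIn N (A t₀) * suc t₀ ≤ 2 * (N + t₀ * k)
  survivors-bound = begin
    countIn N (A t₀) * suc t₀  ≡⟨ length-domain ⟨
    length domain              ≤⟨ length≤2*length event _≟ᴱ_ domain-unique event-∈-codomain events-two-to-one ⟩
    2 * length codomain        ≤⟨ *-monoʳ-≤ 2 length-codomain ⟩
    2 * (N + t₀ * k)           ∎
    where
    open ≤-Reasoning
    _≟ᴱ_ : DecidableEquality Event
    _≟ᴱ_ = ⊎.≡-dec _≟_ (×.≡-dec _≟_ (×.≡-dec _≟ᶠ_ _≟ᶠ_))

countIn≤ : ∀ N (P : ℕ → Bool) → countIn N P ≤ N
countIn≤ N P = ≤-trans (length-filter (T? ∘ P) (range1 N)) (≤-reflexive (length-range1 N))

m<[1+m/n]*n : ∀ m n .{{_ : NonZero n}} → m < suc (m / n) * n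
m<[1+m/n]*n m n = begin-strict
  m                    ≡⟨ m≡m%n+[m/n]*n m n ⟩
  m % n + (m / n) * n  <⟨ +-monoˡ-< ((m / n) * n) (m%n<n m n) ⟩
  suc (m / n) * n      ∎
  where open ≤-Reasoning

m*[1+t]≤2[N+tk]⇒m≤6k : ∀ {m N k t} → N < suc t * (2 * k) → m * suc t ≤ 2 * (N + t * k) → m ≤ 6 * k
m*[1+t]≤2[N+tk]⇒m≤6k {m} {N} {k} {t} N<[1+t]2k bound = <⇒≤ (*-cancelʳ-< (suc t) m (6 * k) (begin-strict
  m * suc t                              ≤⟨ bound ⟩
  2 * (N + t * k)                        <⟨ *-monoʳ-< 2 (+-monoˡ-< (t * k) N<[1+t]2k) ⟩
  2 * (suc t * (2 * k) + t * k)          ≤⟨ m≤m+n _ (2 * k) ⟩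
  2 * (suc t * (2 * k) + t * k) + 2 * k  ≡⟨ regroup k t ⟩
  6 * k * suc t                          ∎))
  where
  open ≤-Reasoning
  regroup : ∀ k t → 2 * (suc t * (2 * k) + t * k) + 2 * k ≡ 6 * k * suc t
  regroup = solve-∀

corollary9 : (n k : ℕ) → 2 ≤ n → 1 ≤ k →
    (T : Graph n) → IsTree T → (r : Fin n) →
    (v : ℕ → Fin n) → IsDFSTour T r (2 * (n ∸ 1)) v →
    (G : ℕ → Graph n) →
    (∀ t → 1 ≤ t → t ≤ 2 * (n ∸ 1) → missingEdges T (G t) ≤ k) →
    (s : ℕ → ℕ → ℕ) → (A : ℕ → ℕ → Bool) →
    IsRun (2 * (n ∸ 1)) v G s A →
    countIn (2 * (n ∸ 1)) (A (divFloor (2 * (n ∸ 1)) (2 * k))) ≤ 6 * k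
corollary9 1 _ (s≤s ())
corollary9 (suc (suc n′)) k@(suc _) _ _ T _ r v tour G few-missing s A run =
  m*[1+t]≤2[N+tk]⇒m≤6k (m<[1+m/n]*n N (2 * k)) (bound (N / (2 * k)) (m/n*n≤m N (2 * k)))
  where
  N : ℕ
  N = 2 * suc n′
  2≤2k : 2 ≤ 2 * k
  2≤2k = *-monoʳ-≤ 2 (s≤s z≤n)
  bound : ∀ t → t * (2 * k) ≤ N → countIn N (A t) * suc t ≤ 2 * (N + t * k)
  bound zero _ = begin
    countIn N (A 0) * 1  ≡⟨ *-identityʳ _ ⟩
    countIn N (A 0)      ≤⟨ countIn≤ N (A 0) ⟩
    N                    ≤⟨ m≤n*m N 2 ⟩
    2 * N                ≡⟨ cong (2 *_) (+-identityʳ N) ⟨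
    2 * (N + 0)          ∎
    where open ≤-Reasoning
  bound t@(suc _) t*2k≤N = Counting.survivors-bound (*-monoʳ-≤ 2 (s≤s z≤n)) tour few-missing run
                             (s≤s z≤n) (<-≤-trans (m<m*n t (2 * k) 2≤2k) t*2k≤N)
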